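{- For every positive integer $n$, as formal power series, $$(1-q)F_n(q,t)=\sum_{a=(a_1,\dots,a_{n-1},0)\in\mathbb Z_{\ge0}^n}q^{\sum_i a_i}t^{d(a)},$$ where $F_n(q,t)=\sum_{a=(a_1,\dots,a_n)\in\mathbb Z_{\ge0}^n}q^{\sum_i a_i}t^{d(a)}$.
   Context: For $a=(a_1,\dots,a_n)\in\mathbb Z_{\ge0}^n$, $d(a)=\#\{(i,j):i<j,\ a_i=a_j\ \text{or}\ a_j=a_i+1\}$. -}

module Defs where

open import Data.Nat using (ℕ; zero; suc; _+_; _∸_; _≡ᵇ_)
open import Data.Bool using (Bool; true; false; _∨_; _∧_)
open import Data.List using (List; []; _∷_; map; concatMap; upTo; length; filterᵇ; foldr)
open import Data.Vec using (Vec; []; _∷_; toList)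
open import Data.Integer using (ℤ; +_; -_) renaming (_+_ to _+ℤ_; _*_ to _*ℤ_)

-- d(a) = #{(i,j) : i < j, a_j = a_i or a_j = a_i + 1}, computed on the list of entries:
-- the head x = a_i is paired with every later entry y = a_j.
dList : List ℕ → ℕ
dList [] = 0
dList (x ∷ xs) = length (filterᵇ (λ y → (y ≡ᵇ x) ∨ (y ≡ᵇ suc x)) xs) + dList xs

d : ∀ {n} → Vec ℕ n → ℕ
d a = dList (toList a)

vecsWithSum : (n m : ℕ) → List (Vec ℕ n)
vecsWithSum zero zero = [] ∷ []
vecsWithSum zero (suc m) = []
vecsWithSum (suc n) m =
  concatMap (λ k → map (k ∷_) (vecsWithSum n (m ∸ k))) (upTo (suc m))

endsInZero : ∀ {n} → Vec ℕ n → Bool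
endsInZero [] = false
endsInZero (x ∷ []) = x ≡ᵇ 0
endsInZero (x ∷ y ∷ ys) = endsInZero (y ∷ ys)

-- formal power series in q, t with integer coefficients:
-- f m k = coefficient of q^m t^k
PowerSeries₂ : Set
PowerSeries₂ = ℕ → ℕ → ℤ

sumℤ : List ℤ → ℤ
sumℤ = foldr _+ℤ_ (+ 0)

_⋆_ : PowerSeries₂ → PowerSeries₂ → PowerSeries₂
(f ⋆ g) m k =
  sumℤ (concatMap (λ i → map (λ j → f i j *ℤ g (m ∸ i) (k ∸ j)) (upTo (suc k))) (upTo (suc m)))

oneMinusQ : PowerSeries₂
oneMinusQ zero zero = + 1
oneMinusQ (suc zero) zero = - (+ 1)
oneMinusQ _ _ = + 0

F : ℕ → PowerSeries₂
F n m k = + length (filterᵇ (λ a → d a ≡ᵇ k) (vecsWithSum n m))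

G : ℕ → PowerSeries₂
G n m k = + length (filterᵇ (λ a → endsInZero a ∧ (d a ≡ᵇ k)) (vecsWithSum n m))

-- Split the vectors counted by F_n into those ending in 0 (counted by G_n) and those ending
-- in a positive entry.  Moving the first entry x of a to the end as x + 1 is a bijection from
-- the vectors of entry sum m onto the vectors of entry sum m + 1 with positive last entry, and it
-- preserves d: the later entries y with y ∈ {x, x + 1} are exactly the earlier entries z with
-- x + 1 ∈ {z, z + 1}.  Hence [q^m] F_n = [q^m] G_n + [q^(m-1)] F_n, which is (1 - q) F_n = G_n.
module Submission where

open import Defs
open import Data.Bool using (Bool; true; false; not; _∧_; _∨_; T)
open import Data.Bool.Properties using (∨-comm; T-∧)
open import Data.Empty using (⊥-elim)
open import Data.Integer using (ℤ; -_; _-_) renaming (+_ to pos; _+_ to _+ℤ_; _*_ to _*ℤ_)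
import Data.Integer.Properties as ℤ
open import Data.List using (List; []; _∷_; [_]; _++_; length; filterᵇ; map; concatMap; upTo; applyUpTo)
open import Data.List.Properties using (length-map; length-++; filter-++; filter-none; filter-≐)
open import Data.List.Membership.Propositional using (_∈_; lose; find)
open import Data.List.Membership.Propositional.Properties
  using (∈-map⁺; ∈-map⁻; ∈-concatMap⁺; ∈-concatMap⁻; ∈-upTo⁺; ∈-upTo⁻; ∈-filter⁺; ∈-filter⁻)
open import Data.List.Membership.Propositional.Properties.WithK using (unique∧set⇒bag)
open import Data.List.Relation.Binary.BagAndSetEquality using (∼bag⇒↭)
open import Data.List.Relation.Binary.Disjoint.Propositional using (Disjoint)
open import Data.List.Relation.Binary.Permutation.Propositional.Properties using (↭-length)
open import Data.List.Relation.Unary.Any using (here)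
open import Data.List.Relation.Unary.All as All using (All)
import Data.List.Relation.Unary.All.Properties as All
import Data.List.Relation.Unary.AllPairs as AllPairs
import Data.List.Relation.Unary.AllPairs.Properties as AllPairs
open import Data.List.Relation.Unary.Unique.Propositional using (Unique)
import Data.List.Relation.Unary.Unique.Propositional.Properties as Unique
open import Data.Nat using (ℕ; zero; suc; _+_; _∸_; _≡ᵇ_; _≤_; s≤s)
open import Data.Nat.Properties
  using (+-suc; +-comm; +-assoc; +-identityʳ; +-commutativeSemigroup; suc-injective; m≤m+n; m+n∸m≡n; m+[n∸m]≡n; ≤-pred)
open import Algebra.Properties.CommutativeSemigroup +-commutativeSemigroup using () renaming (interchange to +-interchange)
open import Data.Product using (∃; _×_; _,_; proj₁)
open import Data.Vec using (Vec; []; _∷_; toList; _∷ʳ_; sum; initLast)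
open import Data.Vec.Properties using (∷-injective; ∷-injectiveˡ; ∷-injectiveʳ; ∷ʳ-injective; toList-∷ʳ)
open import Function using (_∘_; mk⇔; Equivalence)
open import Relation.Binary.PropositionalEquality using (_≡_; refl; sym; trans; cong; cong₂; subst; _≢_; module ≡-Reasoning)
open import Relation.Nullary using (¬_; T?)

private
  variable
    A B : Set
    n : ℕ

countᵇ : (A → Bool) → List A → ℕ
countᵇ p xs = length (filterᵇ p xs)

countᵇ-++ : (p : A → Bool) (xs ys : List A) → countᵇ p (xs ++ ys) ≡ countᵇ p xs + countᵇ p ys
countᵇ-++ p xs ys = trans (cong length (filter-++ (T? ∘ p) xs ys)) (length-++ (filterᵇ p xs))

countᵇ-cong : {p q : A → Bool} → (∀ x → p x ≡ q x) → (xs : List A) → countᵇ p xs ≡ countᵇ q xs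
countᵇ-cong {p = p} {q} p≗q xs =
  cong length (filter-≐ (T? ∘ p) (T? ∘ q) ((λ {x} → subst T (p≗q x)) , (λ {x} → subst T (sym (p≗q x)))) xs)

countᵇ-flip-[-] : (f : A → A → Bool) (x y : A) → countᵇ (f x) [ y ] ≡ countᵇ (λ z → f z y) [ x ]
countᵇ-flip-[-] f x y with f x y
... | true  = refl
... | false = refl

countᵇ-split : (q p : A → Bool) (xs : List A) →
  countᵇ p xs ≡ countᵇ (λ a → q a ∧ p a) xs + countᵇ (λ a → not (q a) ∧ p a) xs
countᵇ-split q p [] = refl
countᵇ-split q p (x ∷ xs) with q x | p x | countᵇ-split q p xs
... | true  | true  | ih = cong suc ih
... | true  | false | ih = ih
... | false | true  | ih = trans (cong suc ih) (sym (+-suc _ _))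
... | false | false | ih = ih

countᵇ-none : (p : A → Bool) (xs : List A) → (∀ {x} → x ∈ xs → ¬ T (p x)) → countᵇ p xs ≡ 0
countᵇ-none p xs none = cong length (filter-none (T? ∘ p) (All.tabulate none))

length-≡-by-bijection : {xs : List A} {ys : List B} (f : A → B) → (∀ {a a′} → f a ≡ f a′ → a ≡ a′) →
  Unique xs → Unique ys → (∀ {a} → a ∈ xs → f a ∈ ys) → (∀ {b} → b ∈ ys → ∃ λ a → a ∈ xs × f a ≡ b) →
  length xs ≡ length ys
length-≡-by-bijection {xs = xs} {ys} f f-inj xs-unique ys-unique into onto =
  trans (sym (length-map f xs))
        (↭-length (∼bag⇒↭ (unique∧set⇒bag (Unique.map⁺ f-inj xs-unique) ys-unique (mk⇔ into′ onto′))))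
  where
  into′ : ∀ {b} → b ∈ map f xs → b ∈ ys
  into′ b∈ with ∈-map⁻ f b∈
  ... | _ , a∈ , refl = into a∈
  onto′ : ∀ {b} → b ∈ ys → b ∈ map f xs
  onto′ b∈ with onto b∈
  ... | _ , a∈ , refl = ∈-map⁺ f a∈

∈-vecsWithSum⁻ : ∀ n m {v : Vec ℕ n} → v ∈ vecsWithSum n m → sum v ≡ m
∈-vecsWithSum⁻ zero    zero    {[]} _ = refl
∈-vecsWithSum⁻ zero    (suc m) ()
∈-vecsWithSum⁻ (suc n) m {x ∷ w} v∈
  with find (∈-concatMap⁻ (λ k → map (k ∷_) (vecsWithSum n (m ∸ k))) {xs = upTo (suc m)} v∈)
... | k , k∈ , v∈row with ∈-map⁻ (k ∷_) v∈row
... | w′ , w′∈ , eq with ∷-injective eq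
... | refl , refl = trans (cong (k +_) (∈-vecsWithSum⁻ n (m ∸ k) w′∈)) (m+[n∸m]≡n (≤-pred (∈-upTo⁻ k∈)))

∈-vecsWithSum⁺ : ∀ n {m} (v : Vec ℕ n) → sum v ≡ m → v ∈ vecsWithSum n m
∈-vecsWithSum⁺ zero    []      refl = here refl
∈-vecsWithSum⁺ (suc n) (x ∷ w) refl =
  ∈-concatMap⁺ (λ k → map (k ∷_) (vecsWithSum n (x + sum w ∸ k)))
    (lose (∈-upTo⁺ (s≤s (m≤m+n x (sum w))))
          (∈-map⁺ (x ∷_) (∈-vecsWithSum⁺ n w (sym (m+n∸m≡n x (sum w))))))

vecsWithSum-unique : ∀ n m → Unique (vecsWithSum n m)
vecsWithSum-unique zero    zero    = All.[] AllPairs.∷ AllPairs.[]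
vecsWithSum-unique zero    (suc m) = AllPairs.[]
vecsWithSum-unique (suc n) m =
  Unique.concat⁺ (All.map⁺ (All.universal (λ k → Unique.map⁺ ∷-injectiveʳ (vecsWithSum-unique n (m ∸ k))) _))
                 (AllPairs.map⁺ (AllPairs.map rows-disjoint (Unique.upTo⁺ (suc m))))
  where
  row : ℕ → List (Vec ℕ (suc n))
  row k = map (k ∷_) (vecsWithSum n (m ∸ k))
  rows-disjoint : ∀ {i j} → i ≢ j → Disjoint (row i) (row j)
  rows-disjoint i≢j (v∈i , v∈j) with ∈-map⁻ _ v∈i | ∈-map⁻ _ v∈j
  ... | _ , _ , refl | _ , _ , eq = i≢j (∷-injectiveˡ eq)

follows : ℕ → ℕ → Bool
follows x y = (y ≡ᵇ x) ∨ (y ≡ᵇ suc x)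

follows-suc : ∀ x z → follows z (suc x) ≡ follows x z
follows-suc x z = trans (∨-comm (suc x ≡ᵇ z) (x ≡ᵇ z)) (cong₂ _∨_ (≡ᵇ-sym x z) (≡ᵇ-sym (suc x) z))
  where
  ≡ᵇ-sym : ∀ a b → (a ≡ᵇ b) ≡ (b ≡ᵇ a)
  ≡ᵇ-sym zero    zero    = refl
  ≡ᵇ-sym zero    (suc b) = refl
  ≡ᵇ-sym (suc a) zero    = refl
  ≡ᵇ-sym (suc a) (suc b) = ≡ᵇ-sym a b

dList-∷ʳ : ∀ xs y → dList (xs ++ [ y ]) ≡ dList xs + countᵇ (λ z → follows z y) xs
dList-∷ʳ []       y = refl
dList-∷ʳ (z ∷ xs) y = begin
  countᵇ (follows z) (xs ++ [ y ]) + dList (xs ++ [ y ])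
    ≡⟨ cong₂ _+_ (countᵇ-++ (follows z) xs [ y ]) (dList-∷ʳ xs y) ⟩
  (countᵇ (follows z) xs + countᵇ (follows z) [ y ]) + (dList xs + countᵇ (λ w → follows w y) xs)
    ≡⟨ +-interchange (countᵇ (follows z) xs) _ _ _ ⟩
  (countᵇ (follows z) xs + dList xs) + (countᵇ (follows z) [ y ] + countᵇ (λ w → follows w y) xs)
    ≡⟨ cong (λ c → countᵇ (follows z) xs + dList xs + (c + _)) (countᵇ-flip-[-] follows z y) ⟩
  (countᵇ (follows z) xs + dList xs) + (countᵇ (λ w → follows w y) [ z ] + countᵇ (λ w → follows w y) xs)
    ≡⟨ cong (countᵇ (follows z) xs + dList xs +_) (countᵇ-++ (λ w → follows w y) [ z ] xs) ⟨
  (countᵇ (follows z) xs + dList xs) + countᵇ (λ w → follows w y) (z ∷ xs) ∎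
  where open ≡-Reasoning

rotate : Vec ℕ (suc n) → Vec ℕ (suc n)
rotate (x ∷ w) = w ∷ʳ suc x

d-rotate : (a : Vec ℕ (suc n)) → d (rotate a) ≡ d a
d-rotate (x ∷ w) = begin
  dList (toList (w ∷ʳ suc x))                          ≡⟨ cong dList (toList-∷ʳ (suc x) w) ⟩
  dList (ws ++ [ suc x ])                              ≡⟨ dList-∷ʳ ws (suc x) ⟩
  dList ws + countᵇ (λ z → follows z (suc x)) ws       ≡⟨ cong (dList ws +_) (countᵇ-cong (follows-suc x) ws) ⟩
  dList ws + countᵇ (follows x) ws                     ≡⟨ +-comm (dList ws) _ ⟩
  d (x ∷ w)                                            ∎
  where
  open ≡-Reasoning
  ws : List ℕ
  ws = toList w

sum-∷ʳ : (w : Vec ℕ n) (y : ℕ) → sum (w ∷ʳ y) ≡ sum w + y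
sum-∷ʳ []      y = +-identityʳ y
sum-∷ʳ (x ∷ w) y = trans (cong (x +_) (sum-∷ʳ w y)) (sym (+-assoc x (sum w) y))

sum-rotate : (a : Vec ℕ (suc n)) → sum (rotate a) ≡ suc (sum a)
sum-rotate (x ∷ w) = trans (sum-∷ʳ w (suc x)) (trans (+-suc (sum w) x) (cong suc (+-comm (sum w) x)))

endsInZero-∷ʳ : (w : Vec ℕ n) (y : ℕ) → endsInZero (w ∷ʳ y) ≡ (y ≡ᵇ 0)
endsInZero-∷ʳ []          y = refl
endsInZero-∷ʳ (x ∷ [])    y = refl
endsInZero-∷ʳ (x ∷ z ∷ w) y = endsInZero-∷ʳ (z ∷ w) y

endsInZero-rotate : (a : Vec ℕ (suc n)) → endsInZero (rotate a) ≡ false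
endsInZero-rotate (x ∷ w) = endsInZero-∷ʳ w (suc x)

rotate-injective : {a b : Vec ℕ (suc n)} → rotate a ≡ rotate b → a ≡ b
rotate-injective {a = x ∷ w} {y ∷ w′} eq with ∷ʳ-injective w w′ eq
... | refl , refl = refl

rotate-onto : (v : Vec ℕ (suc n)) → T (not (endsInZero v)) → ∃ λ a → rotate a ≡ v
rotate-onto v ends≢0 with initLast v
... | w , zero  , refl = ⊥-elim (subst (T ∘ not) (endsInZero-∷ʳ w 0) ends≢0)
... | w , suc x , refl = x ∷ w , refl

hasD : ℕ → Vec ℕ n → Bool
hasD k a = d a ≡ᵇ k

endsPositiveWithD : ℕ → Vec ℕ n → Bool
endsPositiveWithD k a = not (endsInZero a) ∧ hasD k a

endsPositiveWithD-rotate : ∀ k (a : Vec ℕ (suc n)) → endsPositiveWithD k (rotate a) ≡ hasD k a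
endsPositiveWithD-rotate k a = cong₂ (λ e c → not e ∧ (c ≡ᵇ k)) (endsInZero-rotate a) (d-rotate a)

Gᶜ : ℕ → PowerSeries₂
Gᶜ n m k = pos (countᵇ (endsPositiveWithD k) (vecsWithSum n m))

F≡G+Gᶜ : ∀ n m k → F n m k ≡ G n m k +ℤ Gᶜ n m k
F≡G+Gᶜ n m k = trans (cong pos (countᵇ-split endsInZero (hasD k) (vecsWithSum n m)))
                     (ℤ.pos-+ (countᵇ (λ a → endsInZero a ∧ hasD k a) (vecsWithSum n m)) _)

Gᶜ-zero : ∀ n k → Gᶜ (suc n) 0 k ≡ pos 0
Gᶜ-zero n k = cong pos (countᵇ-none (endsPositiveWithD k) (vecsWithSum (suc n) 0) no-positive-ending)
  where
  no-positive-ending : ∀ {v} → v ∈ vecsWithSum (suc n) 0 → ¬ T (endsPositiveWithD k v)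
  no-positive-ending {v} v∈ t with rotate-onto v (Equivalence.to T-∧ t .proj₁)
  ... | a , refl with trans (sym (sum-rotate a)) (∈-vecsWithSum⁻ (suc n) 0 v∈)
  ... | ()

Gᶜ-suc : ∀ n m k → Gᶜ (suc n) (suc m) k ≡ F (suc n) m k
Gᶜ-suc n m k = cong pos (sym (length-≡-by-bijection rotate rotate-injective
  (Unique.filter⁺ (T? ∘ hasD k) (vecsWithSum-unique (suc n) m))
  (Unique.filter⁺ (T? ∘ endsPositiveWithD k) (vecsWithSum-unique (suc n) (suc m)))
  into onto))
  where
  into : ∀ {a} → a ∈ filterᵇ (hasD k) (vecsWithSum (suc n) m) →
         rotate a ∈ filterᵇ (endsPositiveWithD k) (vecsWithSum (suc n) (suc m))
  into {a} a∈ with ∈-filter⁻ (T? ∘ hasD k) a∈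
  ... | a∈′ , t = ∈-filter⁺ (T? ∘ endsPositiveWithD k)
    (∈-vecsWithSum⁺ (suc n) (rotate a) (trans (sum-rotate a) (cong suc (∈-vecsWithSum⁻ (suc n) m a∈′))))
    (subst T (sym (endsPositiveWithD-rotate k a)) t)
  onto : ∀ {v} → v ∈ filterᵇ (endsPositiveWithD k) (vecsWithSum (suc n) (suc m)) →
         ∃ λ a → a ∈ filterᵇ (hasD k) (vecsWithSum (suc n) m) × rotate a ≡ v
  onto {v} v∈ with ∈-filter⁻ (T? ∘ endsPositiveWithD k) v∈
  ... | v∈′ , t with rotate-onto v (Equivalence.to T-∧ t .proj₁)
  ... | a , refl = a , ∈-filter⁺ (T? ∘ hasD k)
    (∈-vecsWithSum⁺ (suc n) a (suc-injective (trans (sym (sum-rotate a)) (∈-vecsWithSum⁻ (suc n) (suc m) v∈′))))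
    (subst T (endsPositiveWithD-rotate k a) t) , refl

sumℤ-++ : (xs ys : List ℤ) → sumℤ (xs ++ ys) ≡ sumℤ xs +ℤ sumℤ ys
sumℤ-++ []       ys = sym (ℤ.+-identityˡ (sumℤ ys))
sumℤ-++ (x ∷ xs) ys = trans (cong (x +ℤ_) (sumℤ-++ xs ys)) (sym (ℤ.+-assoc x (sumℤ xs) (sumℤ ys)))

sumℤ-zeros : {zs : List ℤ} → All (_≡ pos 0) zs → sumℤ zs ≡ pos 0
sumℤ-zeros All.[]            = refl
sumℤ-zeros (refl All.∷ zeros) = trans (ℤ.+-identityˡ _) (sumℤ-zeros zeros)

sumℤ-map-upTo-head : (h : ℕ → ℤ) (k : ℕ) → (∀ j → h (suc j) ≡ pos 0) → sumℤ (map h (upTo (suc k))) ≡ h 0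
sumℤ-map-upTo-head h k h-vanishes =
  trans (cong (h 0 +ℤ_) (sumℤ-zeros (All.map⁺ (All.applyUpTo⁺₂ suc k h-vanishes)))) (ℤ.+-identityʳ (h 0))

oneMinusQ-⋆-zero : (g : PowerSeries₂) (k : ℕ) → (oneMinusQ ⋆ g) 0 k ≡ g 0 k
oneMinusQ-⋆-zero g k = begin
  sumℤ (row ++ [])           ≡⟨ sumℤ-++ row [] ⟩
  sumℤ row +ℤ pos 0          ≡⟨ ℤ.+-identityʳ (sumℤ row) ⟩
  sumℤ row                   ≡⟨ sumℤ-map-upTo-head entry k (λ _ → refl) ⟩
  pos 1 *ℤ g 0 k             ≡⟨ ℤ.*-identityˡ (g 0 k) ⟩
  g 0 k                      ∎
  where
  open ≡-Reasoning
  entry : ℕ → ℤ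
  entry j = oneMinusQ 0 j *ℤ g 0 (k ∸ j)
  row : List ℤ
  row = map entry (upTo (suc k))

oneMinusQ-⋆-suc : (g : PowerSeries₂) (m k : ℕ) → (oneMinusQ ⋆ g) (suc m) k ≡ g (suc m) k - g m k
-- The Cauchy sum unfolds definitionally into the rows i = 0, i = 1 and the rows i ≥ 2, on
-- which oneMinusQ vanishes.
oneMinusQ-⋆-suc g m k = begin
  sumℤ (row 0 ++ row 1 ++ rest)
    ≡⟨ trans (sumℤ-++ (row 0) _) (cong (sumℤ (row 0) +ℤ_) (sumℤ-++ (row 1) rest)) ⟩
  sumℤ (row 0) +ℤ (sumℤ (row 1) +ℤ sumℤ rest)
    ≡⟨ cong₂ (λ r₀ r₁ → r₀ +ℤ (r₁ +ℤ sumℤ rest))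
             (sumℤ-map-upTo-head (entry 0) k (λ _ → refl)) (sumℤ-map-upTo-head (entry 1) k (λ _ → refl)) ⟩
  pos 1 *ℤ g (suc m) k +ℤ (- pos 1 *ℤ g m k +ℤ sumℤ rest)
    ≡⟨ cong₂ _+ℤ_ (ℤ.*-identityˡ (g (suc m) k)) (cong₂ _+ℤ_ (ℤ.-1*i≡-i (g m k)) rest-vanishes) ⟩
  g (suc m) k +ℤ (- g m k +ℤ pos 0)
    ≡⟨ cong (g (suc m) k +ℤ_) (ℤ.+-identityʳ (- g m k)) ⟩
  g (suc m) k - g m k ∎
  where
  open ≡-Reasoning
  entry : ℕ → ℕ → ℤ
  entry i j = oneMinusQ i j *ℤ g (suc m ∸ i) (k ∸ j)
  row : ℕ → List ℤ
  row i = map (entry i) (upTo (suc k))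
  rest : List ℤ
  rest = concatMap row (applyUpTo (suc ∘ suc) m)
  rest-vanishes : sumℤ rest ≡ pos 0
  rest-vanishes = sumℤ-zeros (All.concat⁺ (All.map⁺ (All.applyUpTo⁺₂ (suc ∘ suc) m
    (λ _ → All.map⁺ (All.universal (λ _ → refl) (upTo (suc k)))))))

mainTheorem14 : (n : ℕ) → 1 ≤ n → (m k : ℕ) → (oneMinusQ ⋆ F n) m k ≡ G n m k
mainTheorem14 zero () m k
mainTheorem14 (suc n) _ zero k = begin
  (oneMinusQ ⋆ F (suc n)) 0 k        ≡⟨ oneMinusQ-⋆-zero (F (suc n)) k ⟩
  F (suc n) 0 k                      ≡⟨ F≡G+Gᶜ (suc n) 0 k ⟩
  G (suc n) 0 k +ℤ Gᶜ (suc n) 0 k    ≡⟨ cong (G (suc n) 0 k +ℤ_) (Gᶜ-zero n k) ⟩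
  G (suc n) 0 k +ℤ pos 0             ≡⟨ ℤ.+-identityʳ (G (suc n) 0 k) ⟩
  G (suc n) 0 k                      ∎
  where open ≡-Reasoning
mainTheorem14 (suc n) _ (suc m) k = begin
  (oneMinusQ ⋆ F (suc n)) (suc m) k                   ≡⟨ oneMinusQ-⋆-suc (F (suc n)) m k ⟩
  F (suc n) (suc m) k - F (suc n) m k                 ≡⟨ cong (_- F (suc n) m k) (F≡G+Gᶜ (suc n) (suc m) k) ⟩
  G′ +ℤ Gᶜ (suc n) (suc m) k - F (suc n) m k          ≡⟨ cong (λ c → G′ +ℤ c - F (suc n) m k) (Gᶜ-suc n m k) ⟩
  G′ +ℤ F (suc n) m k - F (suc n) m k                 ≡⟨ ℤ.+-assoc G′ (F (suc n) m k) (- F (suc n) m k) ⟩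
  G′ +ℤ (F (suc n) m k - F (suc n) m k)               ≡⟨ cong (G′ +ℤ_) (ℤ.+-inverseʳ (F (suc n) m k)) ⟩
  G′ +ℤ pos 0                                         ≡⟨ ℤ.+-identityʳ G′ ⟩
  G′                                                  ∎
  where
  open ≡-Reasoning
  G′ : ℤ
  G′ = G (suc n) (suc m) k
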